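{- Let $G$ be a graph with a $k$-colouring $\beta$ and a frozen $(k+1)$-colouring $\gamma$, and let $x,y$ be nonadjacent vertices of $G$ with $\beta(x)\neq\beta(y)$ such that either (1) $\gamma(x)\neq\gamma(y)$, or (2) $\{x,y\}$ is a colour class of $\gamma$. Let $G'$ be the graph obtained from $G$ by adding two new vertices $u,v$, adding the edges $vx$, $xy$, $yu$, and joining each of $u$ and $v$ to all vertices of $G-\{x,y\}$ (with $u,v$ nonadjacent). Then $G'$ is $(k+1)$-colourable and admits a frozen $(k+2)$-colouring. Furthermore: (3) if $\chi(G)=k$, then $\chi(G')=k+1$; (4) if $G$ is $2K_2$-free and, in case (1), there is no edge $rs$ of $G$ such that $\{r,s\}$ is anticomplete to $\{x,y\}$, then $G'$ is $2K_2$-free.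
   Context: A $k$-colouring of a graph is a map assigning to each vertex a colour from $\{1,\dots,k\}$ so that adjacent vertices receive different colours; its colour classes are the sets of vertices with a given colour. A $k$-colouring is frozen if every vertex $v$ has a neighbour of each of the $k$ colours other than its own. Two vertex sets are anticomplete if there is no edge between them. $2K_2$ is the disjoint union of two edges; a graph is $2K_2$-free if it has no induced subgraph isomorphic to $2K_2$. -}

module Defs where

open import Data.Nat using (ℕ; suc)
open import Data.Fin using (Fin; zero; suc)
open import Data.Empty using (⊥)
open import Data.Sum using (_⊎_; inj₁; inj₂)
open import Data.Product using (Σ; _×_; _,_; ∃-syntax)
open import Relation.Nullary using (¬_)
open import Relation.Binary.PropositionalEquality using (_≡_; _≢_; refl; sym)
open import Function.Bundles using (_⇔_)

record Graph (n : ℕ) : Set₁ where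
  field
    E      : Fin n → Fin n → Set
    E-sym  : ∀ {a b} → E a b → E b a
    E-irr  : ∀ {a} → ¬ E a a
open Graph public

record Colouring {n : ℕ} (G : Graph n) (k : ℕ) : Set where
  field
    col    : Fin n → Fin k
    proper : ∀ {a b} → E G a b → col a ≢ col b
open Colouring public

Colourable : ∀ {n} → Graph n → ℕ → Set
Colourable G k = Colouring G k

Frozen : ∀ {n k} (G : Graph n) → Colouring G k → Set
Frozen {n} {k} G c = ∀ (a : Fin n) (j : Fin k) → j ≢ col c a →
  ∃[ w ] (E G a w × col c w ≡ j)

ChromaticNumberIs : ∀ {n} → Graph n → ℕ → Set
ChromaticNumberIs G ℕ.zero = Colourable G 0
ChromaticNumberIs G (suc k) = Colourable G (suc k) × ¬ Colourable G k

-- 2K₂-free: no edges ab, cd with {a,b} anticomplete to {c,d}.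
-- (Distinctness of a,b,c,d then follows from irreflexivity.)
Anticomplete₂ : ∀ {n} → Graph n → Fin n → Fin n → Fin n → Fin n → Set
Anticomplete₂ G a b c d =
  ¬ E G a c × ¬ E G a d × ¬ E G b c × ¬ E G b d

2K₂-free : ∀ {n} → Graph n → Set
2K₂-free G = ∀ a b c d → E G a b → E G c d → ¬ Anticomplete₂ G a b c d

IsColourClass₂ : ∀ {n k} {G : Graph n} → Colouring G k → Fin n → Fin n → Set
IsColourClass₂ {n} c x y = ∀ (w : Fin n) → (col c w ≡ col c x) ⇔ (w ≡ x ⊎ w ≡ y)

-- Vertices of G' are Fin (2 + n):
--   zero = u, suc zero = v, suc (suc w) = the old vertex w.
-- Edges: old edges, plus xy; u ~ y and u ~ every w ∉ {x,y} (i.e. u ~ w iff w ≢ x);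
-- v ~ x and v ~ every w ∉ {x,y} (i.e. v ~ w iff w ≢ y); u ≁ v.
uV vV : ∀ {n} → Fin (suc (suc n))
uV = zero
vV = suc zero
old : ∀ {n} → Fin n → Fin (suc (suc n))
old w = suc (suc w)

module Construction {n : ℕ} (G : Graph n) (x y : Fin n) (x≢y : x ≢ y) where
  E' : Fin (suc (suc n)) → Fin (suc (suc n)) → Set
  E' zero zero = ⊥
  E' zero (suc zero) = ⊥
  E' zero (suc (suc w)) = w ≢ x
  E' (suc zero) zero = ⊥
  E' (suc zero) (suc zero) = ⊥
  E' (suc zero) (suc (suc w)) = w ≢ y
  E' (suc (suc w)) zero = w ≢ x
  E' (suc (suc w)) (suc zero) = w ≢ y
  E' (suc (suc a)) (suc (suc b)) =
    E G a b ⊎ ((a ≡ x × b ≡ y) ⊎ (a ≡ y × b ≡ x))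

  sym' : ∀ {a b} → E' a b → E' b a
  sym' {zero} {suc (suc w)} p = p
  sym' {suc zero} {suc (suc w)} p = p
  sym' {suc (suc w)} {zero} p = p
  sym' {suc (suc w)} {suc zero} p = p
  sym' {suc (suc a)} {suc (suc b)} (inj₁ e) = inj₁ (E-sym G e)
  sym' {suc (suc a)} {suc (suc b)} (inj₂ (inj₁ (p , q))) = inj₂ (inj₂ (q , p))
  sym' {suc (suc a)} {suc (suc b)} (inj₂ (inj₂ (p , q))) = inj₂ (inj₁ (q , p))

  irr' : ∀ {a} → ¬ E' a a
  irr' {zero} ()
  irr' {suc zero} ()
  irr' {suc (suc a)} (inj₁ e) = E-irr G e
  irr' {suc (suc a)} (inj₂ (inj₁ (refl , q))) = x≢y q
  irr' {suc (suc a)} (inj₂ (inj₂ (refl , q))) = x≢y (sym q)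

  G' : Graph (suc (suc n))
  G' = record { E = E' ; E-sym = sym' ; E-irr = irr' }

extend : ∀ {n} (G : Graph n) (x y : Fin n) → x ≢ y → Graph (suc (suc n))
extend G x y x≢y = Construction.G' G x y x≢y

col-≢⇒≢ : ∀ {n k} {G : Graph n} (c : Colouring G k) {x y : Fin n} →
  col c x ≢ col c y → x ≢ y
col-≢⇒≢ c p refl = p refl

{-# OPTIONS --safe #-}
-- The (k+1)-colouring of G' built from β, and in case (1) the frozen (k+2)-colouring built
-- from γ, give u and v one new common colour. In case (2), y moves to a new colour shared with
-- v, and u takes over the colour of x, which x now has alone. Frozenness is checked vertex by
-- vertex: u sees every vertex except x, and v every vertex except y. Conversely, in a
-- (k+1)-colouring of G' only y can share the colour of v, and u is adjacent to every neighbour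
-- of y in G; recolouring y with the colour of u frees the colour of v, leaving a k-colouring
-- of G. For 2K₂-freeness: G + xy is 2K₂-free because every edge of G meets the neighbourhood
-- of {x, y} (in case (2) because a colour class of a frozen colouring is dominating), and no
-- induced 2K₂ of G' passes through u, since the non-neighbours v, x of u are adjacent and the
-- only old vertex missing v is y, which is adjacent to x. Symmetrically for v.
module Submission where

open import Defs
open import Data.Nat using (ℕ; suc)
open import Data.Fin using (Fin; zero; suc; punchOut)
open import Data.Fin.Properties using (_≟_; ¬Fin0; 0≢1+n; suc-injective; punchOut-injective)
open import Data.Empty using (⊥-elim)
open import Data.Sum using (_⊎_; inj₁; inj₂; [_,_])
open import Data.Product using (Σ; _×_; _,_; ∃-syntax)
open import Function using (_∘_; id)
open import Function.Bundles using (Equivalence)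
open import Relation.Nullary using (¬_; yes; no)
open import Relation.Nullary.Decidable using (decidable-stable)
open import Relation.Binary.PropositionalEquality
  using (_≡_; _≢_; refl; sym; trans; cong; ≢-sym)

pattern u = zero
pattern v = suc zero
pattern ↑ w = suc (suc w)

≡-stable : ∀ {m} {a b : Fin m} → ¬ a ≢ b → a ≡ b
≡-stable {a = a} {b} = decidable-stable (a ≟ b)

module _ {n : ℕ} (G : Graph n) where

  adjacent⇒≢ : ∀ {a b} → E G a b → a ≢ b
  adjacent⇒≢ ab refl = E-irr G ab

  neighbour≢nonNeighbour : ∀ {a b c} → E G a b → ¬ E G a c → b ≢ c
  neighbour≢nonNeighbour ab ¬ac refl = ¬ac ab

  shiftColouring : ∀ {k} → Colouring G k → Colouring G (suc k)
  shiftColouring c = record { col = suc ∘ col c ; proper = λ e → proper c e ∘ suc-injective }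

  removeColour : ∀ {k} (c : Colouring G (suc k)) (i : Fin (suc k)) →
    (∀ w → i ≢ col c w) → Colouring G k
  removeColour c i avoids = record
    { col    = λ w → punchOut (avoids w)
    ; proper = λ {a} {b} e → proper c e ∘ punchOut-injective (avoids a) (avoids b)
    }

  freshColourAt : ∀ {k} → Colouring G k → Fin n → Fin n → Fin (suc k)
  freshColourAt c y w with w ≟ y
  ... | yes _ = zero
  ... | no _  = suc (col c w)

  freshColourAt-≡ : ∀ {k} (c : Colouring G k) y → freshColourAt c y y ≡ zero
  freshColourAt-≡ c y with y ≟ y
  ... | yes _   = refl
  ... | no y≢y = ⊥-elim (y≢y refl)

  freshColourAt-≢ : ∀ {k} (c : Colouring G k) {y w} → w ≢ y →
    freshColourAt c y w ≡ suc (col c w)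
  freshColourAt-≢ c {y} {w} w≢y with w ≟ y
  ... | yes w≡y = ⊥-elim (w≢y w≡y)
  ... | no _    = refl

  freshColourAt-suc : ∀ {k} (c : Colouring G k) {y w i} → freshColourAt c y w ≡ suc i →
    w ≢ y × col c w ≡ i
  freshColourAt-suc c {y} {w} eq with w ≟ y
  ... | yes _   = ⊥-elim (0≢1+n eq)
  ... | no w≢y = w≢y , suc-injective eq

  freshColourAt-zero : ∀ {k} (c : Colouring G k) {y w} → freshColourAt c y w ≡ zero → w ≡ y
  freshColourAt-zero c {y} {w} eq with w ≟ y
  ... | yes w≡y = w≡y
  ... | no _    = ⊥-elim (0≢1+n (sym eq))

  freshColour : ∀ {k} → Colouring G k → Fin n → Colouring G (suc k)
  freshColour c y = record { col = freshColourAt c y ; proper = fresh-proper }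
    where
    fresh-proper : ∀ {a b} → E G a b → freshColourAt c y a ≢ freshColourAt c y b
    fresh-proper {a} {b} ab with a ≟ y | b ≟ y
    ... | yes refl | yes refl = ⊥-elim (E-irr G ab)
    ... | yes _    | no _     = 0≢1+n
    ... | no _     | yes _    = 0≢1+n ∘ sym
    ... | no _     | no _     = proper c ab ∘ suc-injective

  module _ {k} (γ : Colouring G k) (frozen : Frozen G γ) where

    frozen⇒everyColourAwayFrom : ∀ {x y} → ¬ E G y x → col γ x ≢ col γ y →
      ∀ j → ∃[ w ] (w ≢ x × col γ w ≡ j)
    frozen⇒everyColourAwayFrom {x} {y} y≁x γx≢γy j with j ≟ col γ x
    ... | yes refl = let w , yw , γw≡j = frozen y j γx≢γy in
      w , neighbour≢nonNeighbour yw y≁x , γw≡j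
    ... | no j≢γx = let w , xw , γw≡j = frozen x j j≢γx in
      w , ≢-sym (adjacent⇒≢ xw) , γw≡j

    module _ {x y} (class : IsColourClass₂ γ x y) where

      adjacentToClass : ∀ {w z} → E G w z → col γ z ≡ col γ x → E G w x ⊎ E G w y
      adjacentToClass wz γz≡γx with Equivalence.to (class _) γz≡γx
      ... | inj₁ refl = inj₁ wz
      ... | inj₂ refl = inj₂ wz

      colourClass-dominating : ∀ w → col γ w ≢ col γ x → E G w x ⊎ E G w y
      colourClass-dominating w γw≢γx =
        let z , wz , γz≡γx = frozen w (col γ x) (≢-sym γw≢γx) in
        adjacentToClass wz γz≡γx

      colourClass-meetsEveryEdge : ∀ r s → E G r s → ¬ Anticomplete₂ G r s x y
      colourClass-meetsEveryEdge r s rs (¬rx , ¬ry , ¬sx , ¬sy) with col γ r ≟ col γ x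
      ... | yes γr≡γx = [ ¬sx , ¬sy ] (adjacentToClass (E-sym G rs) γr≡γx)
      ... | no γr≢γx  = [ ¬rx , ¬ry ] (colourClass-dominating r γr≢γx)

module _ {m : ℕ} (H : Graph m) where

  Anticomplete₂-swap : ∀ {a b c d} → Anticomplete₂ H a b c d → Anticomplete₂ H b a c d
  Anticomplete₂-swap (¬ac , ¬ad , ¬bc , ¬bd) = ¬bc , ¬bd , ¬ac , ¬ad

  Anticomplete₂-sym : ∀ {a b c d} → Anticomplete₂ H a b c d → Anticomplete₂ H c d a b
  Anticomplete₂-sym (¬ac , ¬ad , ¬bc , ¬bd) =
    ¬ac ∘ E-sym H , ¬bc ∘ E-sym H , ¬ad ∘ E-sym H , ¬bd ∘ E-sym H

  2K₂-freeAt : Fin m → Set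
  2K₂-freeAt a = ∀ b c d → E H a b → E H c d → ¬ Anticomplete₂ H a b c d

  2K₂-freeAt-anyPosition : ∀ {a p q r s} → 2K₂-freeAt a →
    a ≡ p ⊎ a ≡ q ⊎ a ≡ r ⊎ a ≡ s →
    E H p q → E H r s → ¬ Anticomplete₂ H p q r s
  2K₂-freeAt-anyPosition free (inj₁ refl) pq rs =
    free _ _ _ pq rs
  2K₂-freeAt-anyPosition free (inj₂ (inj₁ refl)) pq rs =
    free _ _ _ (E-sym H pq) rs ∘ Anticomplete₂-swap
  2K₂-freeAt-anyPosition free (inj₂ (inj₂ (inj₁ refl))) pq rs =
    free _ _ _ rs pq ∘ Anticomplete₂-sym
  2K₂-freeAt-anyPosition free (inj₂ (inj₂ (inj₂ refl))) pq rs =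
    free _ _ _ (E-sym H rs) pq ∘ Anticomplete₂-swap ∘ Anticomplete₂-sym

-- G + xy is realised as the subgraph of extend G x y induced on the old vertices.
addEdge : ∀ {n} (G : Graph n) (x y : Fin n) → x ≢ y → Graph n
addEdge G x y x≢y = record
  { E     = λ a b → E G' (old a) (old b)
  ; E-sym = E-sym G'
  ; E-irr = E-irr G'
  }
  where G' = extend G x y x≢y

module _ {n : ℕ} (G : Graph n) {x y : Fin n} (x≢y : x ≢ y) where

  addEdge-colouring : ∀ {k} (c : Colouring G k) → col c x ≢ col c y →
    Colouring (addEdge G x y x≢y) k
  addEdge-colouring c cx≢cy = record { col = col c ; proper = proper⁺ }
    where
    proper⁺ : ∀ {a b} → E (addEdge G x y x≢y) a b → col c a ≢ col c b
    proper⁺ (inj₁ ab)                   = proper c ab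
    proper⁺ (inj₂ (inj₁ (refl , refl))) = cx≢cy
    proper⁺ (inj₂ (inj₂ (refl , refl))) = ≢-sym cx≢cy

  Anticomplete₂-addEdge⇒ : ∀ {a b c d} → Anticomplete₂ (addEdge G x y x≢y) a b c d →
    Anticomplete₂ G a b c d
  Anticomplete₂-addEdge⇒ (¬ac , ¬ad , ¬bc , ¬bd) =
    ¬ac ∘ inj₁ , ¬ad ∘ inj₁ , ¬bc ∘ inj₁ , ¬bd ∘ inj₁

  anticompleteToNewEdge : ∀ {a b c d} → (c ≡ x × d ≡ y) ⊎ (c ≡ y × d ≡ x) →
    Anticomplete₂ (addEdge G x y x≢y) a b c d → Anticomplete₂ G a b x y
  anticompleteToNewEdge (inj₁ (refl , refl)) anti = Anticomplete₂-addEdge⇒ anti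
  anticompleteToNewEdge (inj₂ (refl , refl)) (¬ay , ¬ax , ¬by , ¬bx) =
    ¬ax ∘ inj₁ , ¬ay ∘ inj₁ , ¬bx ∘ inj₁ , ¬by ∘ inj₁

  newEdge-notAnticompleteToItself : ∀ {a b c d} →
    (a ≡ x × b ≡ y) ⊎ (a ≡ y × b ≡ x) →
    (c ≡ x × d ≡ y) ⊎ (c ≡ y × d ≡ x) →
    ¬ Anticomplete₂ (addEdge G x y x≢y) a b c d
  newEdge-notAnticompleteToItself (inj₁ (refl , refl)) (inj₁ (refl , refl)) (_ , ¬xy , _) =
    ¬xy (inj₂ (inj₁ (refl , refl)))
  newEdge-notAnticompleteToItself (inj₁ (refl , refl)) (inj₂ (refl , refl)) (¬xy , _) =
    ¬xy (inj₂ (inj₁ (refl , refl)))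
  newEdge-notAnticompleteToItself (inj₂ (refl , refl)) (inj₁ (refl , refl)) (¬yx , _) =
    ¬yx (inj₂ (inj₂ (refl , refl)))
  newEdge-notAnticompleteToItself (inj₂ (refl , refl)) (inj₂ (refl , refl)) (_ , ¬yx , _) =
    ¬yx (inj₂ (inj₂ (refl , refl)))

  2K₂-free-addEdge : 2K₂-free G → (∀ r s → E G r s → ¬ Anticomplete₂ G r s x y) →
    2K₂-free (addEdge G x y x≢y)
  2K₂-free-addEdge free _ a b c d (inj₁ ab) (inj₁ cd) =
    free a b c d ab cd ∘ Anticomplete₂-addEdge⇒
  2K₂-free-addEdge _ sep a b c d (inj₂ ab) (inj₁ cd) =
    sep c d cd ∘ anticompleteToNewEdge ab ∘ Anticomplete₂-sym (addEdge G x y x≢y)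
  2K₂-free-addEdge _ sep a b c d (inj₁ ab) (inj₂ cd) =
    sep a b ab ∘ anticompleteToNewEdge cd
  2K₂-free-addEdge _ _ a b c d (inj₂ ab) (inj₂ cd) =
    newEdge-notAnticompleteToItself ab cd

module Extension {n : ℕ} (G : Graph n) (x y : Fin n) (x≢y : x ≢ y) (x≁y : ¬ E G x y) where
  open Construction G x y x≢y using (G')

  G+xy : Graph n
  G+xy = addEdge G x y x≢y

  y≁x : ¬ E G y x
  y≁x = x≁y ∘ E-sym G

  extendColouring : ∀ {k} (c : Colouring G+xy k) (cu cv : Fin k) →
    (∀ w → w ≢ x → cu ≢ col c w) → (∀ w → w ≢ y → cv ≢ col c w) →
    Colouring G' k
  extendColouring {k} c cu cv u-ok v-ok = record { col = colour ; proper = colour-proper }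
    where
    colour : Fin (suc (suc n)) → Fin k
    colour u     = cu
    colour v     = cv
    colour (↑ w) = col c w
    colour-proper : ∀ {a b} → E G' a b → colour a ≢ colour b
    colour-proper {u}   {u}   ()
    colour-proper {u}   {v}   ()
    colour-proper {v}   {u}   ()
    colour-proper {v}   {v}   ()
    colour-proper {u}   {↑ w} w≢x = u-ok w w≢x
    colour-proper {v}   {↑ w} w≢y = v-ok w w≢y
    colour-proper {↑ w} {u}   w≢x = ≢-sym (u-ok w w≢x)
    colour-proper {↑ w} {v}   w≢y = ≢-sym (v-ok w w≢y)
    colour-proper {↑ a} {↑ b} ab  = proper c ab

  liftColouring : ∀ {k} (c : Colouring G k) → col c x ≢ col c y → Colouring G' (suc k)
  liftColouring c cx≢cy =
    extendColouring (shiftColouring G+xy (addEdge-colouring G x≢y c cx≢cy)) zero zero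
      (λ _ _ → 0≢1+n) (λ _ _ → 0≢1+n)

  liftColouring-frozen : ∀ {k} (γ : Colouring G k) → Frozen G γ →
    (γx≢γy : col γ x ≢ col γ y) → Frozen G' (liftColouring γ γx≢γy)
  liftColouring-frozen _ _ _ u zero 0≢0 = ⊥-elim (0≢0 refl)
  liftColouring-frozen _ _ _ v zero 0≢0 = ⊥-elim (0≢0 refl)
  liftColouring-frozen γ frozen γx≢γy u (suc j) _ =
    let w , w≢x , γw≡j = frozen⇒everyColourAwayFrom G γ frozen y≁x γx≢γy j in
    ↑ w , w≢x , cong suc γw≡j
  liftColouring-frozen γ frozen γx≢γy v (suc j) _ =
    let w , w≢y , γw≡j =
          frozen⇒everyColourAwayFrom G γ frozen x≁y (≢-sym γx≢γy) j in
    ↑ w , w≢y , cong suc γw≡j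
  liftColouring-frozen _ _ _ (↑ w) zero _ with w ≟ x
  ... | yes refl = v , x≢y , refl
  ... | no w≢x   = u , w≢x , refl
  liftColouring-frozen γ frozen _ (↑ w) (suc j) sj≢sγw =
    let z , wz , γz≡j = frozen w j (sj≢sγw ∘ cong suc) in
    ↑ z , inj₁ wz , cong suc γz≡j

  module ColourClass {k} (γ : Colouring G k) (class : IsColourClass₂ γ x y) where

    δ : Colouring G (suc k)
    δ = freshColour G γ y

    γy≡γx : col γ y ≡ col γ x
    γy≡γx = Equivalence.from (class y) (inj₂ refl)

    δ-y : col δ y ≡ zero
    δ-y = freshColourAt-≡ G γ y

    δ-x : col δ x ≡ suc (col γ x)
    δ-x = freshColourAt-≢ G γ x≢y

    δ-outsideClass : ∀ {w j} → col γ w ≡ j → j ≢ col γ x → col δ w ≡ suc j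
    δ-outsideClass refl j≢γx =
      freshColourAt-≢ G γ (j≢γx ∘ λ w≡y → trans (cong (col γ) w≡y) γy≡γx)

    δ-zero⇒y : ∀ {w} → col δ w ≡ zero → w ≡ y
    δ-zero⇒y = freshColourAt-zero G γ

    δ-γx⇒x : ∀ {w} → col δ w ≡ suc (col γ x) → w ≡ x
    δ-γx⇒x {w} eq =
      let w≢y , γw≡γx = freshColourAt-suc G γ eq in
      [ id , ⊥-elim ∘ w≢y ] (Equivalence.to (class w) γw≡γx)

    δx≢δy : col δ x ≢ col δ y
    δx≢δy δx≡δy = x≢y (δ-zero⇒y (trans δx≡δy δ-y))

    classColouring : Colouring G' (suc k)
    classColouring =
      extendColouring (addEdge-colouring G x≢y δ δx≢δy) (suc (col γ x)) zero
        (λ _ w≢x → w≢x ∘ δ-γx⇒x ∘ sym) (λ _ w≢y → w≢y ∘ δ-zero⇒y ∘ sym)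

    module _ (frozen : Frozen G γ) where

      frozenAt-y : ∀ j → j ≢ zero → ∃[ t ] (E G' (↑ y) t × col classColouring t ≡ j)
      frozenAt-y zero 0≢0 = ⊥-elim (0≢0 refl)
      frozenAt-y (suc j) _ with j ≟ col γ x
      ... | yes refl = ↑ x , inj₂ (inj₂ (refl , refl)) , δ-x
      ... | no j≢γx =
        let z , yz , γz≡j = frozen y j (j≢γx ∘ λ j≡γy → trans j≡γy γy≡γx) in
        ↑ z , inj₁ yz , δ-outsideClass γz≡j j≢γx

      frozenAt-old : ∀ {w} → w ≢ y → ∀ j → j ≢ suc (col γ w) →
        ∃[ t ] (E G' (↑ w) t × col classColouring t ≡ j)
      frozenAt-old {w} w≢y zero _ with w ≟ x
      ... | yes refl = ↑ y , inj₂ (inj₁ (refl , refl)) , δ-y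
      ... | no w≢x   = v , w≢y , refl
      frozenAt-old {w} w≢y (suc j) sj≢sγw with j ≟ col γ x
      ... | yes refl = u , (sj≢sγw ∘ cong (suc ∘ col γ) ∘ sym) , refl
      ... | no j≢γx =
        let z , wz , γz≡j = frozen w j (sj≢sγw ∘ cong suc) in
        ↑ z , inj₁ wz , δ-outsideClass γz≡j j≢γx

      classColouring-frozen : Frozen G' classColouring
      classColouring-frozen u zero _ = ↑ y , ≢-sym x≢y , δ-y
      classColouring-frozen u (suc j) sj≢sγx =
        let z , xz , γz≡j = frozen x j (sj≢sγx ∘ cong suc) in
        ↑ z , ≢-sym (adjacent⇒≢ G xz) , δ-outsideClass γz≡j (sj≢sγx ∘ cong suc)
      classColouring-frozen v zero 0≢0 = ⊥-elim (0≢0 refl)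
      classColouring-frozen v (suc j) _ with j ≟ col γ x
      ... | yes refl = ↑ x , x≢y , δ-x
      ... | no j≢γx =
        let z , xz , γz≡j = frozen x j j≢γx in
        ↑ z , neighbour≢nonNeighbour G xz x≁y , δ-outsideClass γz≡j j≢γx
      -- Matching on w ≟ y also evaluates col δ w in the type of j≢δw.
      classColouring-frozen (↑ w) j j≢δw with w ≟ y
      ... | yes refl = frozenAt-y j j≢δw
      ... | no w≢y   = frozenAt-old w≢y j j≢δw

  module Restriction {k} (c : Colouring G' (suc k)) where

    colourV⇒y : ∀ {w} → col c (↑ w) ≡ col c v → w ≡ y
    colourV⇒y {w} eq = ≡-stable (λ w≢y → proper c {v} {↑ w} w≢y (sym eq))

    colourU≢neighbourOfY : ∀ {a b} → col c (↑ a) ≡ col c v → E G a b →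
      col c u ≢ col c (↑ b)
    colourU≢neighbourOfY eq ab with colourV⇒y eq
    ... | refl = proper c {u} (neighbour≢nonNeighbour G ab y≁x)

    recoloured : Fin n → Fin (suc k)
    recoloured w with col c (↑ w) ≟ col c v
    ... | yes _ = col c u
    ... | no _  = col c (↑ w)

    recoloured-avoidsV : ∀ w → col c v ≢ recoloured w
    recoloured-avoidsV w with col c (↑ w) ≟ col c v
    ... | no cw≢cv  = ≢-sym cw≢cv
    ... | yes cw≡cv with colourV⇒y cw≡cv
    ...   | refl = λ cv≡cu → proper c {u} {↑ y} (≢-sym x≢y) (trans (sym cv≡cu) (sym cw≡cv))

    recoloured-proper : ∀ {a b} → E G a b → recoloured a ≢ recoloured b
    recoloured-proper {a} {b} ab with col c (↑ a) ≟ col c v | col c (↑ b) ≟ col c v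
    ... | yes ca≡cv | yes cb≡cv = ⊥-elim (proper c (inj₁ ab) (trans ca≡cv (sym cb≡cv)))
    ... | yes ca≡cv | no _      = colourU≢neighbourOfY ca≡cv ab
    ... | no _      | yes cb≡cv = ≢-sym (colourU≢neighbourOfY cb≡cv (E-sym G ab))
    ... | no _      | no _      = proper c (inj₁ ab)

    restrictColouring : Colouring G k
    restrictColouring =
      removeColour G (record { col = recoloured ; proper = recoloured-proper })
        (col c v) recoloured-avoidsV

  chromaticNumber-extend : ∀ {k} (β : Colouring G k) → col β x ≢ col β y →
    ChromaticNumberIs G k → ChromaticNumberIs G' (suc k)
  chromaticNumber-extend {ℕ.zero} β _ _ = ⊥-elim (¬Fin0 (col β x))
  chromaticNumber-extend {suc k} β βx≢βy (_ , ¬k-colourable) =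
    liftColouring β βx≢βy , ¬k-colourable ∘ Restriction.restrictColouring

  u-2K₂-freeAt : 2K₂-freeAt G' u
  u-2K₂-freeAt u _ _ ()
  u-2K₂-freeAt v _ _ ()
  u-2K₂-freeAt (↑ _) u _ _ ud (_ , ¬ud , _) = ¬ud ud
  u-2K₂-freeAt (↑ _) v u _ ()
  u-2K₂-freeAt (↑ _) v v _ ()
  u-2K₂-freeAt (↑ _) v (↑ _) _ _ (_ , ¬ud , ¬wv , ¬wd) =
    ¬wd (inj₂ (inj₂ (≡-stable ¬wv , ≡-stable ¬ud)))
  u-2K₂-freeAt (↑ _) (↑ _) u _ cu (¬uc , _) = ¬uc cu
  u-2K₂-freeAt (↑ _) (↑ _) v _ _ (¬uc , _ , ¬wc , ¬wv) =
    ¬wc (inj₂ (inj₂ (≡-stable ¬wv , ≡-stable ¬uc)))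
  u-2K₂-freeAt (↑ _) (↑ _) (↑ _) _ cd (¬uc , ¬ud , _) =
    adjacent⇒≢ G+xy cd (trans (≡-stable ¬uc) (sym (≡-stable ¬ud)))

  v-2K₂-freeAt : 2K₂-freeAt G' v
  v-2K₂-freeAt u _ _ ()
  v-2K₂-freeAt v _ _ ()
  v-2K₂-freeAt (↑ _) v _ _ vd (_ , ¬vd , _) = ¬vd vd
  v-2K₂-freeAt (↑ _) u u _ ()
  v-2K₂-freeAt (↑ _) u v _ ()
  v-2K₂-freeAt (↑ _) u (↑ _) _ _ (_ , ¬vd , ¬wu , ¬wd) =
    ¬wd (inj₂ (inj₁ (≡-stable ¬wu , ≡-stable ¬vd)))
  v-2K₂-freeAt (↑ _) (↑ _) v _ cv (¬vc , _) = ¬vc cv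
  v-2K₂-freeAt (↑ _) (↑ _) u _ _ (¬vc , _ , ¬wc , ¬wu) =
    ¬wc (inj₂ (inj₁ (≡-stable ¬wu , ≡-stable ¬vc)))
  v-2K₂-freeAt (↑ _) (↑ _) (↑ _) _ cd (¬vc , ¬vd , _) =
    adjacent⇒≢ G+xy cd (trans (≡-stable ¬vc) (sym (≡-stable ¬vd)))

  2K₂-free-extend : 2K₂-free G+xy → 2K₂-free G'
  2K₂-free-extend free (↑ a) (↑ b) (↑ c) (↑ d) = free a b c d
  2K₂-free-extend _ u _ _ _ =
    2K₂-freeAt-anyPosition G' u-2K₂-freeAt (inj₁ refl)
  2K₂-free-extend _ v _ _ _ =
    2K₂-freeAt-anyPosition G' v-2K₂-freeAt (inj₁ refl)
  2K₂-free-extend _ (↑ _) u _ _ =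
    2K₂-freeAt-anyPosition G' u-2K₂-freeAt (inj₂ (inj₁ refl))
  2K₂-free-extend _ (↑ _) v _ _ =
    2K₂-freeAt-anyPosition G' v-2K₂-freeAt (inj₂ (inj₁ refl))
  2K₂-free-extend _ (↑ _) (↑ _) u _ =
    2K₂-freeAt-anyPosition G' u-2K₂-freeAt (inj₂ (inj₂ (inj₁ refl)))
  2K₂-free-extend _ (↑ _) (↑ _) v _ =
    2K₂-freeAt-anyPosition G' v-2K₂-freeAt (inj₂ (inj₂ (inj₁ refl)))
  2K₂-free-extend _ (↑ _) (↑ _) (↑ _) u =
    2K₂-freeAt-anyPosition G' u-2K₂-freeAt (inj₂ (inj₂ (inj₂ refl)))
  2K₂-free-extend _ (↑ _) (↑ _) (↑ _) v =
    2K₂-freeAt-anyPosition G' v-2K₂-freeAt (inj₂ (inj₂ (inj₂ refl)))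

corollary10 : ∀ {n k : ℕ} (G : Graph n) (β : Colouring G k) (γ : Colouring G (suc k))
    → Frozen G γ
    → (x y : Fin n) → (x≁y : ¬ E G x y) → (βxy : col β x ≢ col β y)
    → (case : (col γ x ≢ col γ y) ⊎ IsColourClass₂ γ x y)
    → Colourable (extend G x y (col-≢⇒≢ β βxy)) (suc k)
      × Σ (Colouring (extend G x y (col-≢⇒≢ β βxy)) (suc (suc k)))
          (Frozen (extend G x y (col-≢⇒≢ β βxy)))
      × (ChromaticNumberIs G k → ChromaticNumberIs (extend G x y (col-≢⇒≢ β βxy)) (suc k))
      × (2K₂-free G
         → (col γ x ≢ col γ y → ∀ r s → E G r s → ¬ Anticomplete₂ G r s x y)
         → 2K₂-free (extend G x y (col-≢⇒≢ β βxy)))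
corollary10 {k = k} G β γ frozen x y x≁y βx≢βy case =
  liftColouring β βx≢βy , frozenColouring case , chromaticNumber-extend β βx≢βy ,
  λ free sep → 2K₂-free-extend (2K₂-free-addEdge G x≢y free (meetsEveryEdge case sep))
  where
  x≢y : x ≢ y
  x≢y = col-≢⇒≢ β βx≢βy
  open Extension G x y x≢y x≁y

  frozenColouring : (col γ x ≢ col γ y) ⊎ IsColourClass₂ γ x y →
    Σ (Colouring (extend G x y x≢y) (suc (suc k))) (Frozen (extend G x y x≢y))
  frozenColouring (inj₁ γx≢γy) =
    liftColouring γ γx≢γy , liftColouring-frozen γ frozen γx≢γy
  frozenColouring (inj₂ class) = classColouring , classColouring-frozen frozen
    where open ColourClass γ class

  meetsEveryEdge : (col γ x ≢ col γ y) ⊎ IsColourClass₂ γ x y →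
    (col γ x ≢ col γ y → ∀ r s → E G r s → ¬ Anticomplete₂ G r s x y) →
    ∀ r s → E G r s → ¬ Anticomplete₂ G r s x y
  meetsEveryEdge (inj₁ γx≢γy) sep = sep γx≢γy
  meetsEveryEdge (inj₂ class) _   = colourClass-meetsEveryEdge G γ frozen class
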